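{- Let $G$ be a bipartite graph with bipartition $(X,Y)$ such that $d_G(y)\ge 3$ for all $y\in Y$. If $|X|\ge 3$ and $|Y|\ge 2|X|-2$, then $Y$ has a proper subset $Z$ such that the induced subgraph $G[N[Z]]$ is $3$-connected.
   Context: All graphs are finite and simple. For a vertex set $Z$, $N[Z]=\bigcup_{z\in Z}N[z]$ is its closed neighborhood, where $N[z]$ is $z$ together with its neighbors. A graph is $3$-connected if it has more than $3$ vertices and no vertex cut of size less than $3$. -}

module Defs where

open import Data.Nat using (ℕ; _+_)
open import Data.Bool using (Bool; true; false; _∧_; _∨_)
open import Data.Fin using (Fin; zero; suc)
open import Data.Fin.Subset using (Subset; _∈_; _⊆_; _─_; ∣_∣)
open import Data.Vec using (tabulate; lookup)
open import Data.Sum using (_⊎_; inj₁; inj₂)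
open import Data.Product using (_×_)
open import Data.Empty using (⊥)
open import Relation.Binary.PropositionalEquality using (_≡_)
open import Data.Nat using (_<_)

-- A finite simple bipartite graph with bipartition (X , Y), X = Fin m, Y = Fin k.
-- E x y = true  iff  x ∈ X and y ∈ Y are adjacent.  (Only X–Y edges exist,
-- there are no loops or multiple edges, so the graph is simple.)
BipGraph : ℕ → ℕ → Set
BipGraph m k = Fin m → Fin k → Bool

Vtx : ℕ → ℕ → Set
Vtx m k = Fin m ⊎ Fin k

Adj : ∀ {m k} → BipGraph m k → Vtx m k → Vtx m k → Set
Adj E (inj₁ x) (inj₂ y) = E x y ≡ true
Adj E (inj₂ y) (inj₁ x) = E x y ≡ true
Adj E _ _ = ⊥

degY : ∀ {m k} → BipGraph m k → Fin k → ℕ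
degY E y = ∣ tabulate (λ x → E x y) ∣

record VSubset (m k : ℕ) : Set where
  constructor _,,_
  field
    partX : Subset m
    partY : Subset k
open VSubset public

_∈V_ : ∀ {m k} → Vtx m k → VSubset m k → Set
inj₁ x ∈V S = x ∈ partX S
inj₂ y ∈V S = y ∈ partY S

_⊆V_ : ∀ {m k} → VSubset m k → VSubset m k → Set
S ⊆V T = (partX S ⊆ partX T) × (partY S ⊆ partY T)

_─V_ : ∀ {m k} → VSubset m k → VSubset m k → VSubset m k
S ─V T = (partX S ─ partX T) ,, (partY S ─ partY T)

∣_∣V : ∀ {m k} → VSubset m k → ℕ
∣ S ∣V = ∣ partX S ∣ + ∣ partY S ∣

anyFin : ∀ {n} → (Fin n → Bool) → Bool
anyFin {ℕ.zero} p = false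
anyFin {ℕ.suc n} p = p zero ∨ anyFin (λ i → p (suc i))

closedNbhd : ∀ {m k} → BipGraph m k → Subset k → VSubset m k
closedNbhd E Z = tabulate (λ x → anyFin (λ y → lookup Z y ∧ E x y)) ,, Z

data Walk {m k} (E : BipGraph m k) (S : VSubset m k) : Vtx m k → Vtx m k → Set where
  stay : ∀ {u} → u ∈V S → Walk E S u u
  step : ∀ {u w v} → u ∈V S → Adj E u w → Walk E S w v → Walk E S u v

Connected : ∀ {m k} → BipGraph m k → VSubset m k → Set
Connected E S = ∀ u v → u ∈V S → v ∈V S → Walk E S u v

ThreeConnected : ∀ {m k} → BipGraph m k → VSubset m k → Set
ThreeConnected {m} {k} E S =
  (3 < ∣ S ∣V) × (∀ (C : VSubset m k) → C ⊆V S → ∣ C ∣V < 3 → Connected E (S ─V C))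

{-# OPTIONS --safe #-}
-- Shrink Y minus one vertex, which satisfies 2|N(Z)| ≤ |Z| + 3 because |Y| ≥ 2|X| − 2, to an
-- inclusion-minimal nonempty Z ⊆ Y with 2|N(Z)| ≤ |Z| + 3. Suppose deleting a set C of at most
-- two vertices separated G[N[Z]] into parts R and Q. A part P with Y-vertices has P ∩ Y ⊂ Z, so
-- by minimality |P ∩ Y| + 4 ≤ 2|N(P ∩ Y)| ≤ 2(|P ∩ X| + |C ∩ X|); a part without Y-vertices
-- contains an X-vertex, whose neighbours in Z must then lie in C. Adding these bounds to
-- 2|N(Z)| ≤ |Z| + 3, with |N(Z)| and |Z| split over C, R and Q, is contradictory in every case.
-- Minimum degree 3 gives |N(Z)| ≥ 3, so G[N[Z]] also has more than three vertices.
module Submission where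

open import Defs
open import Data.Nat using (ℕ; _≤_; _*_; _∸_)
open import Data.Fin using (Fin)
open import Data.Fin.Subset using (Subset; _⊂_; ⊤)
open import Data.Product using (Σ; _×_)

open import Data.Bool using (Bool; true; false; _∧_)
import Data.Bool.Properties as Bool
open import Data.Empty using (⊥)
open import Data.Fin using (zero; suc)
open import Data.Fin.Properties using (any?)
open import Data.Fin.Subset
  using (outside; inside; _∈_; _∉_; _⊆_; _∪_; _─_; ⁅_⁆; ∣_∣; Nonempty; Empty)
  renaming (⊥ to ∅)
open import Data.Fin.Subset.Induction using (⊂-wellFounded)
open import Data.Fin.Subset.Properties
open import Data.Nat using (zero; suc; _+_; _<_; z≤n; s≤s; _≤?_)
open import Data.Nat.Properties
open import Data.Nat.Tactic.RingSolver using (solve-∀)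
open import Data.Product using (∃; _,_; proj₁; proj₂)
import Data.Product as Product
open import Data.Sum using (_⊎_; inj₁; inj₂; [_,_]′)
import Data.Sum as Sum
open import Data.Vec using ([]; _∷_; here; there; tabulate; lookup)
open import Data.Vec.Properties using (lookup∘tabulate; []=⇒lookup; lookup⇒[]=)
open import Function using (_∘_; id; case_of_)
open import Induction.WellFounded using (Acc; acc)
open import Level using (Level; 0ℓ)
open import Relation.Binary.PropositionalEquality
  using (_≡_; refl; sym; trans; cong; cong₂; subst; subst₂)
open import Relation.Nullary using (Dec; yes; no; ¬_; contradiction)
open import Relation.Nullary.Decidable using (_×-dec_; _⊎-dec_; ¬?; decidable-stable)
import Relation.Nullary.Decidable as Dec
open import Relation.Unary using (Pred; Decidable)

private
  variable
    ℓ : Level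
    n m k : ℕ

x∈p─q⇒x∉q : ∀ {x : Fin n} (p q : Subset n) → x ∈ p ─ q → x ∉ q
x∈p─q⇒x∉q (_ ∷ p) (outside ∷ q) here       = λ ()
x∈p─q⇒x∉q (_ ∷ p) (_       ∷ q) (there x∈) = λ { (there x∈q) → x∈p─q⇒x∉q p q x∈ x∈q }

q⊆p⇒∣p∣≡∣q∣+∣p─q∣ : ∀ {p q : Subset n} → q ⊆ p → ∣ p ∣ ≡ ∣ q ∣ + ∣ p ─ q ∣
q⊆p⇒∣p∣≡∣q∣+∣p─q∣ {p = []}          {[]}          _   = refl
q⊆p⇒∣p∣≡∣q∣+∣p─q∣ {p = outside ∷ p} {outside ∷ q} q⊆p = q⊆p⇒∣p∣≡∣q∣+∣p─q∣ (drop-∷-⊆ q⊆p)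
q⊆p⇒∣p∣≡∣q∣+∣p─q∣ {p = outside ∷ p} {inside  ∷ q} q⊆p = contradiction (q⊆p here) λ ()
q⊆p⇒∣p∣≡∣q∣+∣p─q∣ {p = inside  ∷ p} {outside ∷ q} q⊆p =
  trans (cong suc (q⊆p⇒∣p∣≡∣q∣+∣p─q∣ (drop-∷-⊆ q⊆p))) (sym (+-suc _ _))
q⊆p⇒∣p∣≡∣q∣+∣p─q∣ {p = inside  ∷ p} {inside  ∷ q} q⊆p =
  cong suc (q⊆p⇒∣p∣≡∣q∣+∣p─q∣ (drop-∷-⊆ q⊆p))

∣p∣≡∣q∣+∣r∣+∣p─q─r∣ : ∀ {p q r : Subset n} → q ⊆ p → r ⊆ p ─ q →
                      ∣ p ∣ ≡ ∣ q ∣ + (∣ r ∣ + ∣ p ─ q ─ r ∣)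
∣p∣≡∣q∣+∣r∣+∣p─q─r∣ {q = q} q⊆p r⊆p─q =
  trans (q⊆p⇒∣p∣≡∣q∣+∣p─q∣ q⊆p) (cong (∣ q ∣ +_) (q⊆p⇒∣p∣≡∣q∣+∣p─q∣ r⊆p─q))

∣p∪q∣≤∣p∣+∣q∣ : ∀ (p q : Subset n) → ∣ p ∪ q ∣ ≤ ∣ p ∣ + ∣ q ∣
∣p∪q∣≤∣p∣+∣q∣ []            []            = z≤n
∣p∪q∣≤∣p∣+∣q∣ (outside ∷ p) (outside ∷ q) = ∣p∪q∣≤∣p∣+∣q∣ p q
∣p∪q∣≤∣p∣+∣q∣ (outside ∷ p) (inside  ∷ q) =
  ≤-trans (s≤s (∣p∪q∣≤∣p∣+∣q∣ p q)) (≤-reflexive (sym (+-suc _ _)))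
∣p∪q∣≤∣p∣+∣q∣ (inside  ∷ p) (s       ∷ q) =
  s≤s (≤-trans (∣p∪q∣≤∣p∣+∣q∣ p q) (+-monoʳ-≤ ∣ p ∣ (∣p∣≤∣x∷p∣ s q)))

nonempty⇒∣p∣>0 : ∀ {p : Subset n} → Nonempty p → 0 < ∣ p ∣
nonempty⇒∣p∣>0 (_ , x∈p) = ≤-<-trans z≤n (x∈p⇒∣p-x∣<∣p∣ x∈p)

empty⇒∣p∣≡0 : ∀ {p : Subset n} → Empty p → ∣ p ∣ ≡ 0
empty⇒∣p∣≡0 {n} p≡∅ = trans (cong ∣_∣ (Empty-unique p≡∅)) (∣⊥∣≡0 n)

x∉p⇒p⊂p∪⁅x⁆ : ∀ {x : Fin n} {p} → x ∉ p → p ⊂ p ∪ ⁅ x ⁆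
x∉p⇒p⊂p∪⁅x⁆ {x = x} {p} x∉p = p⊆p∪q ⁅ x ⁆ , x , q⊆p∪q p ⁅ x ⁆ (x∈⁅x⁆ x) , x∉p

∈tabulate⁺ : ∀ {f : Fin n → Bool} {x} → f x ≡ true → x ∈ tabulate f
∈tabulate⁺ {f = f} {x} fx = lookup⇒[]= x _ (trans (lookup∘tabulate f x) fx)

∈tabulate⁻ : ∀ {f : Fin n → Bool} {x} → x ∈ tabulate f → f x ≡ true
∈tabulate⁻ {f = f} {x} x∈ = trans (sym (lookup∘tabulate f x)) ([]=⇒lookup x∈)

Minimal : Pred (Subset n) ℓ → Pred (Subset n) ℓ
Minimal P W = P W × (∀ {V} → V ⊂ W → ¬ P V)

⊆-minimal : ∀ {P : Pred (Subset n) ℓ} → Decidable P → ∀ {Z} → P Z → ∃ λ W → W ⊆ Z × Minimal P W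
⊆-minimal {P = P} P? PZ = go (⊂-wellFounded _) PZ
  where
  go : ∀ {Z} → Acc _⊂_ Z → P Z → ∃ λ W → W ⊆ Z × Minimal P W
  go {Z} (acc below) PZ with anySubset? (λ V → V ⊂? Z ×-dec P? V)
  ... | yes (V , V⊂Z , PV) = let W , W⊆V , minimal = go (below V⊂Z) PV in
                             W , ⊆-trans W⊆V (proj₁ V⊂Z) , minimal
  ... | no  ∄V             = Z , id , PZ , λ V⊂Z PV → ∄V (_ , V⊂Z , PV)

anyFin⁺ : ∀ (p : Fin n → Bool) {i} → p i ≡ true → anyFin p ≡ true
anyFin⁺ p {zero}  pi rewrite pi = refl
anyFin⁺ p {suc i} pi with p zero
... | true  = refl
... | false = anyFin⁺ (p ∘ suc) pi

anyFin⁻ : ∀ (p : Fin n → Bool) → anyFin p ≡ true → ∃ λ i → p i ≡ true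
anyFin⁻ {suc n} p any with p zero in p0
... | true  = zero , p0
... | false = Product.map suc id (anyFin⁻ (p ∘ suc) any)

∧-≡-true⁻ : ∀ {a b} → a ∧ b ≡ true → a ≡ true × b ≡ true
∧-≡-true⁻ {true} b≡true = refl , b≡true

nbhd : BipGraph m k → Subset k → Subset m
nbhd E W = partX (closedNbhd E W)

∈nbhd⁺ : ∀ (E : BipGraph m k) {W x y} → y ∈ W → E x y ≡ true → x ∈ nbhd E W
∈nbhd⁺ E {W} {x} y∈W exy =
  ∈tabulate⁺ (anyFin⁺ (λ y → lookup W y ∧ E x y) (cong₂ _∧_ ([]=⇒lookup y∈W) exy))

∈nbhd⁻ : ∀ (E : BipGraph m k) {W x} → x ∈ nbhd E W → ∃ λ y → y ∈ W × E x y ≡ true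
∈nbhd⁻ E {W} {x} x∈ with anyFin⁻ (λ y → lookup W y ∧ E x y) (∈tabulate⁻ x∈)
... | y , y∈W∧exy with ∧-≡-true⁻ y∈W∧exy
...   | y∈W , exy = y , lookup⇒[]= y W y∈W , exy

nonempty⇒3≤∣nbhd∣ : ∀ (E : BipGraph m k) → (∀ y → 3 ≤ degY E y) →
                    ∀ {W} → Nonempty W → 3 ≤ ∣ nbhd E W ∣
nonempty⇒3≤∣nbhd∣ E deg (y , y∈W) =
  ≤-trans (deg y) (p⊆q⇒∣p∣≤∣q∣ λ x∈ → ∈nbhd⁺ E y∈W (∈tabulate⁻ x∈))

Sparse : BipGraph m k → Pred (Subset k) 0ℓ
Sparse E W = Nonempty W × 2 * ∣ nbhd E W ∣ ≤ ∣ W ∣ + 3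

sparse? : ∀ (E : BipGraph m k) → Decidable (Sparse E)
sparse? E W = nonempty? W ×-dec (2 * ∣ nbhd E W ∣ ≤? ∣ W ∣ + 3)

Adj-sym : ∀ {E : BipGraph m k} {v w} → Adj E v w → Adj E w v
Adj-sym {v = inj₁ _} {inj₂ _} exy = exy
Adj-sym {v = inj₂ _} {inj₁ _} exy = exy

adj? : ∀ (E : BipGraph m k) v w → Dec (Adj E v w)
adj? E (inj₁ x) (inj₂ y) = E x y Bool.≟ true
adj? E (inj₂ y) (inj₁ x) = E x y Bool.≟ true
adj? E (inj₁ _) (inj₁ _) = no λ ()
adj? E (inj₂ _) (inj₂ _) = no λ ()

anyVtx? : ∀ {P : Pred (Vtx m k) ℓ} → Decidable P → Dec (∃ P)
anyVtx? P? = Dec.map′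
  [ (λ (x , Px) → inj₁ x , Px) , (λ (y , Py) → inj₂ y , Py) ]′
  (λ { (inj₁ x , Px) → inj₁ (x , Px) ; (inj₂ y , Py) → inj₂ (y , Py) })
  (any? (P? ∘ inj₁) ⊎-dec any? (P? ∘ inj₂))

_∈V?_ : ∀ (v : Vtx m k) S → Dec (v ∈V S)
inj₁ x ∈V? S = x ∈? partX S
inj₂ y ∈V? S = y ∈? partY S

∈V─⁺ : ∀ {v : Vtx m k} {S T} → v ∈V S → ¬ v ∈V T → v ∈V (S ─V T)
∈V─⁺ {v = inj₁ _} = x∈p∧x∉q⇒x∈p─q
∈V─⁺ {v = inj₂ _} = x∈p∧x∉q⇒x∈p─q

∈V─⁻ : ∀ {v : Vtx m k} S T → v ∈V (S ─V T) → v ∈V S × ¬ v ∈V T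
∈V─⁻ {v = inj₁ _} S T v∈ = p─q⊆p (partX S) (partX T) v∈ , x∈p─q⇒x∉q (partX S) (partX T) v∈
∈V─⁻ {v = inj₂ _} S T v∈ = p─q⊆p (partY S) (partY T) v∈ , x∈p─q⇒x∉q (partY S) (partY T) v∈

∅V : VSubset m k
∅V = ∅ ,, ∅

∉∅V : ∀ {v : Vtx m k} → ¬ v ∈V ∅V
∉∅V {v = inj₁ _} = ∉⊥
∉∅V {v = inj₂ _} = ∉⊥

insertV : Vtx m k → VSubset m k → VSubset m k
insertV (inj₁ x) S = (partX S ∪ ⁅ x ⁆) ,, partY S
insertV (inj₂ y) S = partX S ,, (partY S ∪ ⁅ y ⁆)

∈insertV-here : ∀ (v : Vtx m k) S → v ∈V insertV v S
∈insertV-here (inj₁ x) S = q⊆p∪q (partX S) ⁅ x ⁆ (x∈⁅x⁆ x)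
∈insertV-here (inj₂ y) S = q⊆p∪q (partY S) ⁅ y ⁆ (x∈⁅x⁆ y)

∈insertV-there : ∀ (v : Vtx m k) {w} S → w ∈V S → w ∈V insertV v S
∈insertV-there (inj₁ x) {inj₁ _} S = p⊆p∪q ⁅ x ⁆
∈insertV-there (inj₁ x) {inj₂ _} S = id
∈insertV-there (inj₂ y) {inj₁ _} S = id
∈insertV-there (inj₂ y) {inj₂ _} S = p⊆p∪q ⁅ y ⁆

∈insertV⁻ : ∀ (v : Vtx m k) {w} S → w ∈V insertV v S → w ≡ v ⊎ w ∈V S
∈insertV⁻ (inj₁ x) {inj₁ _} S w∈ =
  Sum.swap (Sum.map₂ (cong inj₁ ∘ x∈⁅y⁆⇒x≡y x) (x∈p∪q⁻ (partX S) ⁅ x ⁆ w∈))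
∈insertV⁻ (inj₁ x) {inj₂ _} S w∈ = inj₂ w∈
∈insertV⁻ (inj₂ y) {inj₁ _} S w∈ = inj₂ w∈
∈insertV⁻ (inj₂ y) {inj₂ _} S w∈ =
  Sum.swap (Sum.map₂ (cong inj₂ ∘ x∈⁅y⁆⇒x≡y y) (x∈p∪q⁻ (partY S) ⁅ y ⁆ w∈))

v∉S⇒∣S∣V<∣insertV∣V : ∀ {v : Vtx m k} S → ¬ v ∈V S → ∣ S ∣V < ∣ insertV v S ∣V
v∉S⇒∣S∣V<∣insertV∣V {v = inj₁ x} S x∉S = +-monoˡ-< ∣ partY S ∣ (p⊂q⇒∣p∣<∣q∣ (x∉p⇒p⊂p∪⁅x⁆ x∉S))
v∉S⇒∣S∣V<∣insertV∣V {v = inj₂ y} S y∉S = +-monoʳ-< ∣ partX S ∣ (p⊂q⇒∣p∣<∣q∣ (x∉p⇒p⊂p∪⁅x⁆ y∉S))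

∣S∣V≤m+k : ∀ (S : VSubset m k) → ∣ S ∣V ≤ m + k
∣S∣V≤m+k S = +-mono-≤ (∣p∣≤n (partX S)) (∣p∣≤n (partY S))

walk-source∈ : ∀ {E : BipGraph m k} {T u v} → Walk E T u v → u ∈V T
walk-source∈ (stay u∈)     = u∈
walk-source∈ (step u∈ _ _) = u∈

Closed : BipGraph m k → VSubset m k → VSubset m k → Set
Closed E T R = ∀ {v w} → v ∈V T → Adj E v w → w ∈V R → v ∈V R

Closed-complement : ∀ {E : BipGraph m k} {T R} → Closed E T R → Closed E T (T ─V R)
Closed-complement {T = T} {R} closed {v} v∈T adj w∈T─R with ∈V─⁻ T R w∈T─R | v ∈V? R
... | w∈T , w∉R | yes v∈R = contradiction (closed w∈T (Adj-sym adj) v∈R) w∉R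
... | _         | no  v∉R = ∈V─⁺ v∈T v∉R

record Component (E : BipGraph m k) (T : VSubset m k) (t : Vtx m k) : Set where
  field
    members   : VSubset m k
    t∈members : t ∈V members
    closed    : Closed E T members
    walk      : ∀ {v} → v ∈V members → Walk E T v t

  members⊆T : members ⊆V T
  members⊆T = walk-source∈ ∘ walk {inj₁ _} , walk-source∈ ∘ walk {inj₂ _}

module _ (E : BipGraph m k) (T : VSubset m k) {t : Vtx m k} where

  Frontier : VSubset m k → Set
  Frontier R = ∃ λ v → (v ∈V T × ¬ v ∈V R) × ∃ λ w → Adj E v w × w ∈V R

  frontier? : ∀ R → Dec (Frontier R)
  frontier? R =
    anyVtx? λ v → (v ∈V? T ×-dec ¬? (v ∈V? R)) ×-dec anyVtx? λ w → adj? E v w ×-dec w ∈V? R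

  grow : ∀ n R → t ∈V R → (∀ {v} → v ∈V R → Walk E T v t) → m + k ≤ n + ∣ R ∣V → Component E T t
  grow n R t∈R walk fuel with frontier? R
  ... | no ∄frontier = record { members = R ; t∈members = t∈R ; closed = closed ; walk = walk }
    where
    closed : Closed E T R
    closed {v} v∈T adj w∈R =
      decidable-stable (v ∈V? R) λ v∉R → ∄frontier (v , (v∈T , v∉R) , _ , adj , w∈R)
  ... | yes (v , (v∈T , v∉R) , w , adj , w∈R) = grow-by n fuel
    where
    walk' : ∀ {u} → u ∈V insertV v R → Walk E T u t
    walk' u∈ with ∈insertV⁻ v R u∈
    ... | inj₁ refl = step v∈T adj (walk w∈R)
    ... | inj₂ u∈R  = walk u∈R

    ∣R∣<∣R'∣ : ∣ R ∣V < ∣ insertV v R ∣V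
    ∣R∣<∣R'∣ = v∉S⇒∣S∣V<∣insertV∣V R v∉R

    grow-by : ∀ n → m + k ≤ n + ∣ R ∣V → Component E T t
    grow-by zero    fuel = contradiction
      (<-≤-trans ∣R∣<∣R'∣ (≤-trans (∣S∣V≤m+k (insertV v R)) fuel)) (<-irrefl refl)
    grow-by (suc n) fuel = grow n (insertV v R) (∈insertV-there v R t∈R) walk'
      (≤-trans fuel (≤-trans (≤-reflexive (sym (+-suc n _))) (+-monoʳ-≤ n ∣R∣<∣R'∣)))

  component : t ∈V T → Component E T t
  component t∈T = grow (m + k) (insertV t ∅V) (∈insertV-here t ∅V) walk₀ (m≤m+n (m + k) _)
    where
    walk₀ : ∀ {v} → v ∈V insertV t ∅V → Walk E T v t
    walk₀ v∈ with ∈insertV⁻ t ∅V v∈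
    ... | inj₁ refl = stay t∈T
    ... | inj₂ v∈∅  = contradiction v∈∅ ∉∅V

-- (cx , cy), (px , py) and (qx , qy) are the sizes on X and on Y of a cut C and of the two
-- parts into which C would separate G[N[Z]]; in each lemma the hypotheses sum to 1 + s ≤ s.
private
  -- Matching a≡1+s against refl instead makes checking the callers below very slow.
  sum-absurd : ∀ {a s} → a ≤ s → a ≡ suc s → ⊥
  sum-absurd {s = s} a≤s a≡1+s = n≮n s (≤-trans (≤-reflexive (sym a≡1+s)) a≤s)

  infixl 6 _⊕_
  _⊕_ : ∀ {a b c d} → a ≤ b → c ≤ d → a + c ≤ b + d
  _⊕_ = +-mono-≤

both-parts-meet-Y-absurd : ∀ {cx cy px py qx qy} → cx + cy ≤ 2 →
  2 * (cx + (px + qx)) ≤ cy + (py + qy) + 3 →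
  py + 3 < 2 * (px + cx) → qy + 3 < 2 * (qx + cx) → ⊥
both-parts-meet-Y-absurd {cx} {cy} {px} {py} {qx} {qy} c≤2 sparse p-expands q-expands =
  sum-absurd (p-expands ⊕ q-expands ⊕ sparse ⊕ c≤2 ⊕ ≤-trans (m≤m+n cx cy) c≤2)
             (total cx cy px py qx qy)
  where
  total : ∀ cx cy px py qx qy →
    suc (py + 3) + suc (qy + 3) + 2 * (cx + (px + qx)) + (cx + cy) + cx ≡
    suc (2 * (px + cx) + 2 * (qx + cx) + (cy + (py + qy) + 3) + 2 + 2)
  total = solve-∀

one-part-meets-Y-absurd : ∀ {cx cy px py qx qy} → cy ≤ 2 →
  2 * (cx + (px + qx)) ≤ cy + (py + qy) + 3 → qy ≡ 0 →
  py + 3 < 2 * (px + cx) → 0 < qx → ⊥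
one-part-meets-Y-absurd {cx} {cy} {px} {py} {qx} {qy} cy≤2 sparse qy≡0 p-expands qx>0 =
  sum-absurd (p-expands ⊕ sparse ⊕ *-monoʳ-≤ 2 qx>0 ⊕ cy≤2 ⊕ ≤-reflexive qy≡0)
             (total cx cy px py qx qy)
  where
  total : ∀ cx cy px py qx qy →
    suc (py + 3) + 2 * (cx + (px + qx)) + 2 * 1 + cy + qy ≡
    suc (2 * (px + cx) + (cy + (py + qy) + 3) + 2 * qx + 2 + 0)
  total = solve-∀

no-part-meets-Y-absurd : ∀ {cy n py qy} → cy ≤ 2 →
  2 * n ≤ cy + (py + qy) + 3 → py ≡ 0 → qy ≡ 0 → 3 ≤ n → ⊥
no-part-meets-Y-absurd {cy} {n} {py} {qy} cy≤2 sparse py≡0 qy≡0 3≤n =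
  sum-absurd (*-monoʳ-≤ 2 3≤n ⊕ sparse ⊕ cy≤2 ⊕ ≤-reflexive py≡0 ⊕ ≤-reflexive qy≡0)
             (total cy n py qy)
  where
  total : ∀ cy n py qy →
    2 * 3 + 2 * n + cy + py + qy ≡ suc (2 * n + (cy + (py + qy) + 3) + 2 + 0 + 0)
  total = solve-∀

module Separation (E : BipGraph m k) (deg : ∀ y → 3 ≤ degY E y)
  {Z : Subset k} (minimal : Minimal (Sparse E) Z)
  {C : VSubset m k} (C⊆S : C ⊆V closedNbhd E Z) (∣C∣≤2 : ∣ C ∣V ≤ 2) where

  T : VSubset m k
  T = closedNbhd E Z ─V C

  Cy≤2 : ∣ partY C ∣ ≤ 2
  Cy≤2 = ≤-trans (m≤n+m _ _) ∣C∣≤2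

  module Part {P : VSubset m k} (P⊆T : P ⊆V T) (closed : Closed E T P) where

    Py⊆Z : partY P ⊆ Z
    Py⊆Z y∈P = p─q⊆p Z (partY C) (proj₂ P⊆T y∈P)

    Cy≢∅⇒Py⊂Z : Nonempty (partY C) → partY P ⊂ Z
    Cy≢∅⇒Py⊂Z (y , y∈C) =
      Py⊆Z , y , proj₂ C⊆S y∈C , λ y∈P → x∈p─q⇒x∉q Z (partY C) (proj₂ P⊆T y∈P) y∈C

    nbhd-Py⊆Px∪Cx : nbhd E (partY P) ⊆ partX P ∪ partX C
    nbhd-Py⊆Px∪Cx {x} x∈N with ∈nbhd⁻ E x∈N | x ∈? partX C
    ... | _ , _ , _     | yes x∈C = q⊆p∪q (partX P) (partX C) x∈C
    ... | y , y∈P , exy | no  x∉C = p⊆p∪q (partX C)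
      (closed {inj₁ x} {inj₂ y} (x∈p∧x∉q⇒x∈p─q (∈nbhd⁺ E (Py⊆Z y∈P) exy) x∉C) exy y∈P)

    Py-expands : Nonempty (partY P) → partY P ⊂ Z →
                 ∣ partY P ∣ + 3 < 2 * (∣ partX P ∣ + ∣ partX C ∣)
    Py-expands Py≢∅ Py⊂Z = <-≤-trans
      (≰⇒> λ Py-sparse → proj₂ minimal Py⊂Z (Py≢∅ , Py-sparse))
      (*-monoʳ-≤ 2 (≤-trans (p⊆q⇒∣p∣≤∣q∣ nbhd-Py⊆Px∪Cx) (∣p∪q∣≤∣p∣+∣q∣ (partX P) (partX C))))

    Py≡∅⇒Px≢∅×Cy≢∅ : Empty (partY P) → ∀ {v} → v ∈V P → Nonempty (partX P) × Nonempty (partY C)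
    Py≡∅⇒Px≢∅×Cy≢∅ Py≡∅ {inj₂ y} y∈P = contradiction (y , y∈P) Py≡∅
    Py≡∅⇒Px≢∅×Cy≢∅ Py≡∅ {inj₁ x} x∈P with ∈nbhd⁻ E (p─q⊆p (nbhd E Z) (partX C) (proj₁ P⊆T x∈P))
    ... | y , y∈Z , exy with y ∈? partY C
    ...   | yes y∈C = (x , x∈P) , (y , y∈C)
    ...   | no  y∉C = contradiction
      (y , closed {inj₂ y} {inj₁ x} (x∈p∧x∉q⇒x∈p─q y∈Z y∉C) exy x∈P) Py≡∅

  module _ {R : VSubset m k} (R⊆T : R ⊆V T) (R-closed : Closed E T R) where

    Q : VSubset m k
    Q = T ─V R

    private
      module R = Part R⊆T R-closed
      module Q = Part {Q} (p─q⊆p _ _ , p─q⊆p _ _) (Closed-complement R-closed)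

    ∣nbhd∣-split : ∣ nbhd E Z ∣ ≡ ∣ partX C ∣ + (∣ partX R ∣ + ∣ partX Q ∣)
    ∣nbhd∣-split = ∣p∣≡∣q∣+∣r∣+∣p─q─r∣ (proj₁ C⊆S) (proj₁ R⊆T)

    ∣Z∣-split : ∣ Z ∣ ≡ ∣ partY C ∣ + (∣ partY R ∣ + ∣ partY Q ∣)
    ∣Z∣-split = ∣p∣≡∣q∣+∣r∣+∣p─q─r∣ (proj₂ C⊆S) (proj₂ R⊆T)

    sparse : 2 * (∣ partX C ∣ + (∣ partX R ∣ + ∣ partX Q ∣)) ≤
             ∣ partY C ∣ + (∣ partY R ∣ + ∣ partY Q ∣) + 3
    sparse = subst₂ (λ a b → 2 * a ≤ b + 3) ∣nbhd∣-split ∣Z∣-split (proj₂ (proj₁ minimal))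

    no-separation : ∀ {u v} → v ∈V R → u ∈V Q → ⊥
    no-separation v∈R u∈Q with nonempty? (partY R) | nonempty? (partY Q)
    ... | yes Ry≢∅@(y , y∈R) | yes Qy≢∅@(y' , y'∈Q) =
      both-parts-meet-Y-absurd {cx = ∣ partX C ∣} {px = ∣ partX R ∣} {qx = ∣ partX Q ∣} ∣C∣≤2 sparse
        (R.Py-expands Ry≢∅ (R.Py⊆Z , y' , Q.Py⊆Z y'∈Q , x∈p─q⇒x∉q _ _ y'∈Q))
        (Q.Py-expands Qy≢∅ (Q.Py⊆Z , y , R.Py⊆Z y∈R , λ y∈Q → x∈p─q⇒x∉q _ _ y∈Q y∈R))
    ... | yes Ry≢∅ | no Qy≡∅ =
      let Qx≢∅ , Cy≢∅ = Q.Py≡∅⇒Px≢∅×Cy≢∅ Qy≡∅ u∈Q in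
      one-part-meets-Y-absurd {cx = ∣ partX C ∣} {px = ∣ partX R ∣} {qx = ∣ partX Q ∣}
        Cy≤2 sparse (empty⇒∣p∣≡0 Qy≡∅)
        (R.Py-expands Ry≢∅ (R.Cy≢∅⇒Py⊂Z Cy≢∅)) (nonempty⇒∣p∣>0 Qx≢∅)
    ... | no Ry≡∅ | yes Qy≢∅ =
      let Rx≢∅ , Cy≢∅ = R.Py≡∅⇒Px≢∅×Cy≢∅ Ry≡∅ v∈R in
      one-part-meets-Y-absurd {cx = ∣ partX C ∣} {px = ∣ partX Q ∣} {qx = ∣ partX R ∣}
        Cy≤2 sparse-swapped (empty⇒∣p∣≡0 Ry≡∅)
        (Q.Py-expands Qy≢∅ (Q.Cy≢∅⇒Py⊂Z Cy≢∅)) (nonempty⇒∣p∣>0 Rx≢∅)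
      where
      sparse-swapped : 2 * (∣ partX C ∣ + (∣ partX Q ∣ + ∣ partX R ∣)) ≤
                       ∣ partY C ∣ + (∣ partY Q ∣ + ∣ partY R ∣) + 3
      sparse-swapped = subst₂ (λ a b → 2 * (∣ partX C ∣ + a) ≤ ∣ partY C ∣ + b + 3)
        (+-comm (∣ partX R ∣) _) (+-comm (∣ partY R ∣) _) sparse
    ... | no Ry≡∅ | no Qy≡∅ =
      no-part-meets-Y-absurd Cy≤2 sparse (empty⇒∣p∣≡0 Ry≡∅) (empty⇒∣p∣≡0 Qy≡∅)
        (subst (3 ≤_) ∣nbhd∣-split (nonempty⇒3≤∣nbhd∣ E deg (proj₁ (proj₁ minimal))))

minimal-sparse⇒threeConnected : ∀ (E : BipGraph m k) → (∀ y → 3 ≤ degY E y) →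
  ∀ {Z} → Minimal (Sparse E) Z → ThreeConnected E (closedNbhd E Z)
minimal-sparse⇒threeConnected E deg {Z} minimal@((Z≢∅ , _) , _) =
  +-mono-≤ (nonempty⇒3≤∣nbhd∣ E deg Z≢∅) (nonempty⇒∣p∣>0 Z≢∅) , no-small-cut
  where
  no-small-cut : ∀ C → C ⊆V closedNbhd E Z → ∣ C ∣V < 3 → Connected E (closedNbhd E Z ─V C)
  no-small-cut C C⊆S ∣C∣<3 u v u∈T v∈T = walk (decidable-stable (u ∈V? members) λ u∉R →
    no-separation members⊆T closed t∈members (∈V─⁺ u∈T u∉R))
    where
    open Component (component E (closedNbhd E Z ─V C) v∈T)
    open Separation E deg minimal C⊆S (≤-pred ∣C∣<3)

all-but-first : Subset (suc n)
all-but-first = outside ∷ ⊤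

⊆all-but-first⇒⊂⊤ : ∀ {Z : Subset (suc n)} → Z ⊆ all-but-first → Z ⊂ ⊤
⊆all-but-first⇒⊂⊤ Z⊆ = (λ _ → ∈⊤) , zero , ∈⊤ , λ 0∈Z → case Z⊆ 0∈Z of λ ()

all-but-first-sparse : ∀ (E : BipGraph m (suc (suc k))) → 2 * m ∸ 2 ≤ suc (suc k) →
                       Sparse E all-but-first
all-but-first-sparse {m} {k} E 2m∸2≤k = (suc zero , there ∈⊤) , (begin
  2 * ∣ nbhd E all-but-first ∣  ≤⟨ *-monoʳ-≤ 2 (∣p∣≤n (nbhd E all-but-first)) ⟩
  2 * m                         ≤⟨ m≤n+m∸n (2 * m) 2 ⟩
  2 + (2 * m ∸ 2)               ≤⟨ +-monoʳ-≤ 2 2m∸2≤k ⟩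
  3 + suc k                     ≡⟨ +-comm 3 (suc k) ⟩
  suc k + 3                     ≡⟨ cong (_+ 3) (sym (∣⊤∣≡n (suc k))) ⟩
  ∣ all-but-first {suc k} ∣ + 3 ∎)
  where open ≤-Reasoning

corollary3p4 : (m k : ℕ) (E : BipGraph m k)
    → (∀ (y : Fin k) → 3 ≤ degY E y)
    → 3 ≤ m
    → 2 * m ∸ 2 ≤ k
    → Σ (Subset k) (λ Z → (Z ⊂ ⊤) × ThreeConnected E (closedNbhd E Z))
corollary3p4 m k E deg 3≤m 2m∸2≤k with ≤-trans (∸-monoˡ-≤ 2 (*-monoʳ-≤ 2 3≤m)) 2m∸2≤k
... | s≤s (s≤s _) with ⊆-minimal (sparse? E) (all-but-first-sparse E 2m∸2≤k)
...   | Z , Z⊆Y₀ , minimal =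
  Z , ⊆all-but-first⇒⊂⊤ Z⊆Y₀ , minimal-sparse⇒threeConnected E deg minimal
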